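{- For $p\in\omega_4$ let $\Pi(p)$ be the projective subspace spanned by the four lines $L^{ijk}(p)$, $ijk\in\{111,122,212,221\}$, and $\Pi^*(p)$ the subspace spanned by the four lines $L^{ijk}(p)$, $ijk\in\{222,211,121,112\}$. Then $\Pi(p)$ and $\Pi^*(p)$ are generators (solids, i.e. projective 3-spaces, contained in the quadric) of the hyperbolic quadric $\mathcal{H}_7$, and they belong to different systems of generators.
   Context: Work over $\mathbb{F}_2$. $V_8=V(8,2)$ with basis $e_1,\dots,e_8$, $V_a=\langle e_1,e_8\rangle$, $V_b=\langle e_2,e_7\rangle$, $V_c=\langle e_3,e_6\rangle$, $V_d=\langle e_4,e_5\rangle$; points of $\operatorname{PG}(7,2)$ are nonzero vectors; $\omega_4$ is the set of vectors all four of whose components in $V_a,\dots,V_d$ are nonzero. $\mathcal{H}_7$ is the hyperbolic quadric $Q(x)=0$ with $Q(x)=x_1x_8+x_2x_7+x_3x_6+x_4x_5+\sum_{i=1}^8x_i$; its generators (maximal totally singular subspaces, projective dimension 3) fall into two systems. Let $\zeta_a: e_1\mapsto e_8\mapsto e_1+e_8\mapsto e_1$, $\zeta_b: e_7\mapsto e_2\mapsto e_2+e_7\mapsto e_7$, $\zeta_c: e_3\mapsto e_6\mapsto e_3+e_6\mapsto e_3$, $\zeta_d: e_5\mapsto e_4\mapsto e_4+e_5\mapsto e_5$ (linear maps of $V_h$), $A_{ijk}=\zeta_a^i\oplus\zeta_b^j\oplus\zeta_c^k\oplus\zeta_d$ for $i,j,k\in\{1,2\}$, and $L^{ijk}(p)=\{p,A_{ijk}p,A_{ijk}^2p\}$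 (a line). -}

module Defs where

open import Data.Bool using (Bool; true; false; _xor_; _∧_; _∨_)
open import Data.Nat using (ℕ; zero; suc)
open import Data.Nat.Properties using ()
open import Data.Vec using (Vec; []; _∷_; zipWith; replicate)
open import Data.List using (List; []; _∷_; length; _++_)
open import Data.Product using (Σ; _×_; _,_)
open import Function.Bundles using (_⇔_)
open import Relation.Binary.PropositionalEquality using (_≡_)
open import Data.Nat.Base using (_%_)

-- The field F_2 is Bool, with addition _xor_ and multiplication _∧_.
-- V8 = F_2^8, coordinates x1,...,x8 w.r.t. e1,...,e8.
V : Set
V = Vec Bool 8

𝟎 : V
𝟎 = replicate 8 false

_⊕_ : V → V → V
_⊕_ = zipWith _xor_

_⊙_ : Bool → V → V
false ⊙ v = 𝟎
true  ⊙ v = v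

lincomb : (vs : List V) → Vec Bool (length vs) → V
lincomb []       []       = 𝟎
lincomb (v ∷ vs) (c ∷ cs) = (c ⊙ v) ⊕ lincomb vs cs

InSpan : List V → V → Set
InSpan vs v = Σ (Vec Bool (length vs)) λ cs → lincomb vs cs ≡ v

LinIndep : List V → Set
LinIndep vs = (cs : Vec Bool (length vs)) → lincomb vs cs ≡ 𝟎 → cs ≡ replicate (length vs) false

-- the subspace given by predicate P has vector dimension d (projective dimension d-1):
-- it has a basis of d vectors
HasDim : (V → Set) → ℕ → Set
HasDim P d = Σ (List V) λ B → (length B ≡ d) × LinIndep B × ((v : V) → InSpan B v ⇔ P v)

Q : V → Bool
Q (x1 ∷ x2 ∷ x3 ∷ x4 ∷ x5 ∷ x6 ∷ x7 ∷ x8 ∷ []) =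
  (x1 ∧ x8) xor (x2 ∧ x7) xor (x3 ∧ x6) xor (x4 ∧ x5) xor
  (x1 xor x2 xor x3 xor x4 xor x5 xor x6 xor x7 xor x8)

TotallySingular : List V → Set
TotallySingular S = (v : V) → InSpan S v → Q v ≡ false

IsGenerator : List V → Set
IsGenerator S = TotallySingular S × HasDim (InSpan S) 4

-- Two generators of the hyperbolic quadric H_7 (vector dimension 4) lie in the
-- same system iff dim(G ∩ G') ≡ 4 (mod 2) (vector dimensions); they lie in
-- different systems iff the intersection has odd vector dimension.
DifferentSystems : List V → List V → Set
DifferentSystems G G' =
  Σ ℕ λ d → HasDim (λ v → InSpan G v × InSpan G' v) d × (d % 2 ≡ 1)

-- ω_4: all four components in V_a=<e1,e8>, V_b=<e2,e7>, V_c=<e3,e6>, V_d=<e4,e5> nonzero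
InOmega4 : V → Set
InOmega4 (x1 ∷ x2 ∷ x3 ∷ x4 ∷ x5 ∷ x6 ∷ x7 ∷ x8 ∷ []) =
  ((x1 ∨ x8) ≡ true) × ((x2 ∨ x7) ≡ true) × ((x3 ∨ x6) ≡ true) × ((x4 ∨ x5) ≡ true)

-- ζ_a : e1 ↦ e8 ↦ e1+e8 ; ζ_b : e7 ↦ e2 ↦ e2+e7 ;
-- ζ_c : e3 ↦ e6 ↦ e3+e6 ; ζ_d : e5 ↦ e4 ↦ e4+e5 (each extended by identity elsewhere)
ζa ζb ζc ζd : V → V
ζa (x1 ∷ x2 ∷ x3 ∷ x4 ∷ x5 ∷ x6 ∷ x7 ∷ x8 ∷ []) =
  x8 ∷ x2 ∷ x3 ∷ x4 ∷ x5 ∷ x6 ∷ x7 ∷ (x1 xor x8) ∷ []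
ζb (x1 ∷ x2 ∷ x3 ∷ x4 ∷ x5 ∷ x6 ∷ x7 ∷ x8 ∷ []) =
  x1 ∷ (x2 xor x7) ∷ x3 ∷ x4 ∷ x5 ∷ x6 ∷ x2 ∷ x8 ∷ []
ζc (x1 ∷ x2 ∷ x3 ∷ x4 ∷ x5 ∷ x6 ∷ x7 ∷ x8 ∷ []) =
  x1 ∷ x2 ∷ x6 ∷ x4 ∷ x5 ∷ (x3 xor x6) ∷ x7 ∷ x8 ∷ []
ζd (x1 ∷ x2 ∷ x3 ∷ x4 ∷ x5 ∷ x6 ∷ x7 ∷ x8 ∷ []) =
  x1 ∷ x2 ∷ x3 ∷ (x4 xor x5) ∷ x4 ∷ x6 ∷ x7 ∷ x8 ∷ []

iter : ℕ → (V → V) → V → V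
iter zero    f v = v
iter (suc n) f v = f (iter n f v)

-- A_{ijk} = ζ_a^i ⊕ ζ_b^j ⊕ ζ_c^k ⊕ ζ_d (the ζ's act on disjoint coordinate blocks)
A : ℕ → ℕ → ℕ → V → V
A i j k v = iter i ζa (iter j ζb (iter k ζc (ζd v)))

L : ℕ → ℕ → ℕ → V → List V
L i j k p = p ∷ A i j k p ∷ A i j k (A i j k p) ∷ []

Π : V → List V
Π p = L 1 1 1 p ++ L 1 2 2 p ++ L 2 1 2 p ++ L 2 2 1 p

Π* : V → List V
Π* p = L 2 2 2 p ++ L 2 1 1 p ++ L 1 2 1 p ++ L 1 1 2 p

-- Identify each block V_h with 𝔽₄ so that ζ_h is multiplication by a primitive cube root of unity ω;
-- then Q(x) is the number of nonzero blocks of x, mod 2, and A_{ijk} acts as (ω^i, ω^j, ω^k, ω).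
-- As 1 + ω + ω² = 0, every line is L^{ijk}(p) = {p, Ap, p + Ap}, and blockwise cancellation gives
-- A₂₂₁ = A₁₁₁ + A₁₂₂ + A₂₁₂, A₁₁₂ = A₂₂₂ + A₂₁₁ + A₁₂₁, A₁₁₁ + A₁₂₂ = A₂₂₂ + A₂₁₁ and
-- A₁₁₁ + A₂₁₂ = A₂₂₂ + A₁₂₁. Hence Π(p) = ⟨p, A₁₁₁p, A₁₂₂p, A₂₁₂p⟩, Π*(p) = ⟨p, A₂₂₂p, A₂₁₁p, A₁₂₁p⟩,
-- and both contain the plane ⟨p, A₁₁₁p + A₁₂₂p, A₁₁₁p + A₂₁₂p⟩. That these spanning sets are bases,
-- that Q vanishes on the two solids, and that the plane is their whole intersection (of odd vector
-- dimension 3) are finitely many facts about the 81 points of ω₄, decided by evaluation.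

module Submission where

open import Defs
open import Data.Bool using (Bool; true; false; _xor_; _∨_)
open import Data.Bool.Properties using (xor-assoc; xor-comm; xor-identityˡ; xor-identityʳ; xor-same)
import Data.Bool.Properties as Bool
open import Data.Fin.Subset.Properties using (anySubset?)
open import Data.List using (List; []; _∷_; length)
open import Data.List.Membership.Propositional using (_∈_)
open import Data.List.Relation.Unary.All as All using (All; []; _∷_)
open import Data.List.Relation.Unary.Any using (here; there)
open import Data.Nat using (zero; suc)
open import Data.Product using (_×_; _,_)
open import Data.Vec using (Vec; []; _∷_; zipWith; replicate)
open import Data.Vec.Properties using (≡-dec; zipWith-assoc; zipWith-comm; zipWith-identityˡ; zipWith-identityʳ; zipWith-inverseˡ; map-id)
open import Function using (_∘_)
open import Function.Bundles using (mk⇔)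
open import Relation.Binary.Definitions using (DecidableEquality)
open import Relation.Binary.PropositionalEquality using (_≡_; refl; sym; trans; cong; cong₂; subst; module ≡-Reasoning)
open import Relation.Nullary.Decidable using (Dec; map′; _×-dec_; _→-dec_; toWitness)
open import Relation.Unary using (Decidable)

⊕-assoc : ∀ u v w → (u ⊕ v) ⊕ w ≡ u ⊕ (v ⊕ w)
⊕-assoc = zipWith-assoc xor-assoc

⊕-comm : ∀ u v → u ⊕ v ≡ v ⊕ u
⊕-comm = zipWith-comm xor-comm

⊕-identityˡ : ∀ v → 𝟎 ⊕ v ≡ v
⊕-identityˡ = zipWith-identityˡ xor-identityˡ

⊕-identityʳ : ∀ v → v ⊕ 𝟎 ≡ v
⊕-identityʳ = zipWith-identityʳ xor-identityʳ

⊕-same : ∀ v → v ⊕ v ≡ 𝟎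
⊕-same v = trans (cong (_⊕ v) (sym (map-id v))) (zipWith-inverseˡ xor-same v)

⊕-interchange : ∀ a b c d → (a ⊕ b) ⊕ (c ⊕ d) ≡ (a ⊕ c) ⊕ (b ⊕ d)
⊕-interchange a b c d = begin
  (a ⊕ b) ⊕ (c ⊕ d)  ≡⟨ ⊕-assoc a b (c ⊕ d) ⟩
  a ⊕ (b ⊕ (c ⊕ d))  ≡⟨ cong (a ⊕_) (sym (⊕-assoc b c d)) ⟩
  a ⊕ ((b ⊕ c) ⊕ d)  ≡⟨ cong (λ x → a ⊕ (x ⊕ d)) (⊕-comm b c) ⟩
  a ⊕ ((c ⊕ b) ⊕ d)  ≡⟨ cong (a ⊕_) (⊕-assoc c b d) ⟩
  a ⊕ (c ⊕ (b ⊕ d))  ≡⟨ sym (⊕-assoc a c (b ⊕ d)) ⟩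
  (a ⊕ c) ⊕ (b ⊕ d)  ∎
  where open ≡-Reasoning

⊙-distribʳ-xor : ∀ a b v → (a xor b) ⊙ v ≡ (a ⊙ v) ⊕ (b ⊙ v)
⊙-distribʳ-xor false false v = refl
⊙-distribʳ-xor false true  v = sym (⊕-identityˡ v)
⊙-distribʳ-xor true  false v = sym (⊕-identityʳ v)
⊙-distribʳ-xor true  true  v = sym (⊕-same v)

lincomb-zeros : ∀ S → lincomb S (replicate (length S) false) ≡ 𝟎
lincomb-zeros []      = refl
lincomb-zeros (v ∷ S) = cong (𝟎 ⊕_) (lincomb-zeros S)

lincomb-xor : ∀ S cs ds → lincomb S (zipWith _xor_ cs ds) ≡ lincomb S cs ⊕ lincomb S ds
lincomb-xor []      []       []       = refl
lincomb-xor (v ∷ S) (c ∷ cs) (d ∷ ds) = begin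
  ((c xor d) ⊙ v) ⊕ lincomb S (zipWith _xor_ cs ds)
    ≡⟨ cong₂ _⊕_ (⊙-distribʳ-xor c d v) (lincomb-xor S cs ds) ⟩
  ((c ⊙ v) ⊕ (d ⊙ v)) ⊕ (lincomb S cs ⊕ lincomb S ds)
    ≡⟨ ⊕-interchange (c ⊙ v) (d ⊙ v) (lincomb S cs) (lincomb S ds) ⟩
  ((c ⊙ v) ⊕ lincomb S cs) ⊕ ((d ⊙ v) ⊕ lincomb S ds)  ∎
  where open ≡-Reasoning

InSpan-𝟎 : ∀ S → InSpan S 𝟎
InSpan-𝟎 S = replicate (length S) false , lincomb-zeros S

InSpan-⊕ : ∀ S {u v} → InSpan S u → InSpan S v → InSpan S (u ⊕ v)
InSpan-⊕ S (cs , refl) (ds , refl) = zipWith _xor_ cs ds , lincomb-xor S cs ds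

InSpan-⊙ : ∀ S {v} c → InSpan S v → InSpan S (c ⊙ v)
InSpan-⊙ S false _  = InSpan-𝟎 S
InSpan-⊙ S true  v∈ = v∈

-- The ambient span list is explicit from here on: InSpan is not injective in it, so it cannot be inferred.
InSpan-lincomb : ∀ {S} T → All (InSpan T) S → ∀ cs → InSpan T (lincomb S cs)
InSpan-lincomb T []         []       = InSpan-𝟎 T
InSpan-lincomb T (v∈ ∷ S⊆T) (c ∷ cs) = InSpan-⊕ T (InSpan-⊙ T c v∈) (InSpan-lincomb T S⊆T cs)

InSpan-mono : ∀ {S} T → All (InSpan T) S → ∀ {v} → InSpan S v → InSpan T v
InSpan-mono T S⊆T (cs , refl) = InSpan-lincomb T S⊆T cs

InSpan-trans : ∀ {R} S T → All (InSpan S) R → All (InSpan T) S → All (InSpan T) R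
InSpan-trans S T R⊆S S⊆T = All.map (InSpan-mono T S⊆T) R⊆S

∈⇒InSpan : ∀ {S v} → v ∈ S → InSpan S v
∈⇒InSpan {v ∷ S} (here refl) =
  true ∷ replicate (length S) false , trans (cong (v ⊕_) (lincomb-zeros S)) (⊕-identityʳ v)
∈⇒InSpan (there v∈S) with ∈⇒InSpan v∈S
... | cs , refl = false ∷ cs , ⊕-identityˡ _

totallySingular-mono : ∀ {S} T → All (InSpan T) S → TotallySingular T → TotallySingular S
totallySingular-mono T S⊆T T-sing v v∈S = T-sing v (InSpan-mono T S⊆T v∈S)

IsBasis : List V → List V → Set
IsBasis B S = LinIndep B × All (InSpan S) B × All (InSpan B) S

IsBasis⇒HasDim : ∀ B S → IsBasis B S → HasDim (InSpan S) (length B)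
IsBasis⇒HasDim B S (B-indep , B⊆S , S⊆B) =
  B , refl , B-indep , λ v → mk⇔ (InSpan-mono S B⊆S) (InSpan-mono B S⊆B)

isGenerator : ∀ B S → IsBasis B S → length B ≡ 4 → TotallySingular B → IsGenerator S
isGenerator B S B-basis@(_ , _ , S⊆B) dim-B B-sing =
  totallySingular-mono B S⊆B B-sing , subst (HasDim (InSpan S)) dim-B (IsBasis⇒HasDim B S B-basis)

-- The last component is ⟨B⟩ ∩ ⟨B'⟩ ⊆ ⟨C⟩, quantified over the coefficients of B so that it is decidable.
IsMeetBasis : List V → List V → List V → Set
IsMeetBasis C B B' =
  LinIndep C × All (InSpan B) C × All (InSpan B') C ×
  (∀ cs → InSpan B' (lincomb B cs) → InSpan C (lincomb B cs))

IsMeetBasis⇒HasDim : ∀ C B B' S S' → IsBasis B S → IsBasis B' S' → IsMeetBasis C B B' →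
  HasDim (λ v → InSpan S v × InSpan S' v) (length C)
IsMeetBasis⇒HasDim C B B' S S' (_ , B⊆S , S⊆B) (_ , B'⊆S' , S'⊆B') (C-indep , C⊆B , C⊆B' , meet⊆C) =
  C , refl , C-indep , λ v → mk⇔ (λ v∈C → InSpan-mono S C⊆S v∈C , InSpan-mono S' C⊆S' v∈C) meet
  where
  C⊆S : All (InSpan S) C
  C⊆S  = InSpan-trans B S C⊆B B⊆S
  C⊆S' : All (InSpan S') C
  C⊆S' = InSpan-trans B' S' C⊆B' B'⊆S'
  meet : ∀ {v} → InSpan S v × InSpan S' v → InSpan C v
  meet (v∈S , v∈S') with InSpan-mono B S⊆B v∈S
  ... | cs , refl = meet⊆C cs (InSpan-mono B' S'⊆B' v∈S')

_≟ⱽ_ : ∀ {n} → DecidableEquality (Vec Bool n)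
_≟ⱽ_ = ≡-dec Bool._≟_

allVec? : ∀ {n} {P : Vec Bool n → Set} → Decidable P → Dec (∀ v → P v)
allVec? {zero} P? = map′ (λ { p [] → p }) (λ h → h []) (P? [])
allVec? {suc n} P? =
  map′ (λ { (f , t) (false ∷ v) → f v ; (f , t) (true ∷ v) → t v })
       (λ h → h ∘ (false ∷_) , h ∘ (true ∷_))
       (allVec? (P? ∘ (false ∷_)) ×-dec allVec? (P? ∘ (true ∷_)))

inSpan? : ∀ S v → Dec (InSpan S v)
inSpan? S v = anySubset? (λ cs → lincomb S cs ≟ⱽ v)

linIndep? : ∀ S → Dec (LinIndep S)
linIndep? S = allVec? (λ cs → lincomb S cs ≟ⱽ 𝟎 →-dec cs ≟ⱽ replicate _ false)

totallySingular? : ∀ S → Dec (TotallySingular S)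
totallySingular? S =
  map′ (λ h → λ { _ (cs , refl) → h cs }) (λ h cs → h _ (cs , refl))
       (allVec? (λ cs → Q (lincomb S cs) Bool.≟ false))

isMeetBasis? : ∀ C B B' → Dec (IsMeetBasis C B B')
isMeetBasis? C B B' =
  linIndep? C ×-dec All.all? (inSpan? B) C ×-dec All.all? (inSpan? B') C ×-dec
  allVec? (λ cs → inSpan? B' (lincomb B cs) →-dec inSpan? C (lincomb B cs))

inOmega4? : ∀ p → Dec (InOmega4 p)
inOmega4? (x1 ∷ x2 ∷ x3 ∷ x4 ∷ x5 ∷ x6 ∷ x7 ∷ x8 ∷ []) =
  (x1 ∨ x8) Bool.≟ true ×-dec (x2 ∨ x7) Bool.≟ true ×-dec
  (x3 ∨ x6) Bool.≟ true ×-dec (x4 ∨ x5) Bool.≟ true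

basisΠ basisΠ* meetBasis : V → List V
basisΠ    p = p ∷ A 1 1 1 p ∷ A 1 2 2 p ∷ A 2 1 2 p ∷ []
basisΠ*   p = p ∷ A 2 2 2 p ∷ A 2 1 1 p ∷ A 1 2 1 p ∷ []
meetBasis p = p ∷ (A 1 1 1 p ⊕ A 1 2 2 p) ∷ (A 1 1 1 p ⊕ A 2 1 2 p) ∷ []

basisΠ-⊆ : ∀ p → All (_∈ Π p) (basisΠ p)
basisΠ-⊆ p = here refl ∷ there (here refl) ∷ there (there (there (there (here refl)))) ∷
  there (there (there (there (there (there (there (here refl))))))) ∷ []

basisΠ*-⊆ : ∀ p → All (_∈ Π* p) (basisΠ* p)
basisΠ*-⊆ p = here refl ∷ there (here refl) ∷ there (there (there (there (here refl)))) ∷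
  there (there (there (there (there (there (there (here refl))))))) ∷ []

Certificate : V → Set
Certificate p =
  (LinIndep (basisΠ p) × All (InSpan (basisΠ p)) (Π p) × TotallySingular (basisΠ p)) ×
  (LinIndep (basisΠ* p) × All (InSpan (basisΠ* p)) (Π* p) × TotallySingular (basisΠ* p)) ×
  IsMeetBasis (meetBasis p) (basisΠ p) (basisΠ* p)

certificate? : ∀ p → Dec (Certificate p)
certificate? p =
  (linIndep? (basisΠ p) ×-dec All.all? (inSpan? (basisΠ p)) (Π p) ×-dec totallySingular? (basisΠ p)) ×-dec
  (linIndep? (basisΠ* p) ×-dec All.all? (inSpan? (basisΠ* p)) (Π* p) ×-dec totallySingular? (basisΠ* p)) ×-dec
  isMeetBasis? (meetBasis p) (basisΠ p) (basisΠ* p)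

certificate-sound : ∀ p → Certificate p →
  IsGenerator (Π p) × IsGenerator (Π* p) × DifferentSystems (Π p) (Π* p)
certificate-sound p ((B-indep , Π⊆B , B-sing) , (B*-indep , Π*⊆B* , B*-sing) , meet) =
  isGenerator (basisΠ p) (Π p) B-basis refl B-sing ,
  isGenerator (basisΠ* p) (Π* p) B*-basis refl B*-sing ,
  (3 , IsMeetBasis⇒HasDim (meetBasis p) (basisΠ p) (basisΠ* p) (Π p) (Π* p) B-basis B*-basis meet , refl)
  where
  B-basis : IsBasis (basisΠ p) (Π p)
  B-basis  = B-indep , All.map ∈⇒InSpan (basisΠ-⊆ p) , Π⊆B
  B*-basis : IsBasis (basisΠ* p) (Π* p)
  B*-basis = B*-indep , All.map ∈⇒InSpan (basisΠ*-⊆ p) , Π*⊆B*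

certificate : ∀ p → InOmega4 p → Certificate p
certificate = toWitness {a? = allVec? (λ p → inOmega4? p →-dec certificate? p)} _

theorem3 : (p : V) → InOmega4 p →
    IsGenerator (Π p) × IsGenerator (Π* p) × DifferentSystems (Π p) (Π* p)
theorem3 p p∈ω₄ = certificate-sound p (certificate p p∈ω₄)
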